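{- Let $D=(V_N,E_N)$ be a finite directed acyclic graph with a single sink $r$ such that every node has a directed path to $r$, let $G=(V,E)$ be its line dependency graph, and let $k$ be a positive integer. Define $\lambda(u)$ for a vertex $u$ of $G$ and $\lambda(u,w)$ for a pair of vertices of $G$ as below, and construct $G'=(V',E')$ by: $dl=\{u\in V:\lambda(u)>k\}$, $V'=V\setminus dl$; $el=\{\{u,w\}: u,w\in V',\ u\neq w,\ \{u,w\}\notin E,\ \lambda(u,w)>k\}$; and $E'$ consists of the edges of $E\cup el$ with both endpoints in $V'$. If $S$ is a maximal independent set of $G$ with $|S|\le k$, then $S$ is also a maximal independent set of $G'$.
   Context: The edges of $D$ are called lines; the sources of $D$ (nodes with no incoming edges) are its primary inputs. Two distinct lines are transitively dependent if some directed path from a source to $r$ contains both. The line dependency graph $G$ of $D$ has the lines of $D$ as vertices, two being adjacent iff they are transitively dependent. An independent set of $G$ is a set of pairwise non-adjacent vertices; it is maximal if it is not a proper subset of another independent set. For a set $A$ of vertices of $G$, assign capacity $\infty$ to each line that is a neighbor in $G$ of some element of $A$ (and not itself in $A$) and capacity $1$ to every other line, and let $\lambda_A$ be the minimum, over all sets $F$ of lines whose removal eliminates every directed path from a source to $r$, of the total capacity of $F$ (equivalently, the minimum $s$-$t$ cut value in the network with a super-source joined by infinite-capacity edges to all sources and the sink $r$ joined to a super-sink by an infinite-capacity edge). Set $\lambda(u)=\lambda_{\{u\}}$ and $\lambda(u,w)=\lambda_{\{u,w\}}$. -}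

module Defs where

open import Data.Nat using (ℕ; _≤_; _<_)
open import Data.Fin using (Fin)
open import Data.Fin.Subset using (Subset; _∈_; _∉_; _⊆_; _⊂_; ∣_∣)
open import Data.Product using (Σ; ∃; _×_; _,_)
open import Data.Sum using (_⊎_)
open import Relation.Binary.PropositionalEquality using (_≡_; _≢_)
open import Relation.Nullary using (¬_)
open import Data.Empty using (⊥)
open import Data.Unit using (⊤)

data ℕ∞ : Set where
  fin : ℕ → ℕ∞
  ∞   : ℕ∞

data _≤∞_ : ℕ∞ → ℕ∞ → Set where
  fin≤fin : ∀ {a b} → a ≤ b → fin a ≤∞ fin b
  _≤∞∞    : ∀ x → x ≤∞ ∞

data _<∞_ : ℕ → ℕ∞ → Set where
  fin<fin : ∀ {a b} → a < b → a <∞ fin b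
  _<∞∞    : ∀ a → a <∞ ∞

record Digraph : Set where
  field
    n    : ℕ
    m    : ℕ
    tail : Fin m → Fin n
    head : Fin m → Fin n

module _ (D : Digraph) where
  open Digraph D

  Node : Set
  Node = Fin n

  Line : Set
  Line = Fin m

  -- no parallel lines (D is a simple digraph: E_N is a set of ordered pairs)
  NoParallel : Set
  NoParallel = ∀ e f → tail e ≡ tail f → head e ≡ head f → e ≡ f

  -- directed walks (in a DAG these are exactly the directed paths)
  data Walk : Node → Node → Set where
    []   : ∀ {x} → Walk x x
    step : ∀ {x y} (e : Line) → tail e ≡ x → Walk (head e) y → Walk x y

  data OnWalk (e : Line) : ∀ {x y} → Walk x y → Set where
    here  : ∀ {x y} (p : tail e ≡ x) (w : Walk (head e) y) → OnWalk e (step e p w)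
    there : ∀ {x y} (f : Line) (p : tail f ≡ x) (w : Walk (head f) y) →
            OnWalk e w → OnWalk e (step f p w)

  nonEmpty : ∀ {x y} → Walk x y → Set
  nonEmpty [] = ⊥
  nonEmpty (step _ _ _) = ⊤

  Acyclic : Set
  Acyclic = ∀ x (w : Walk x x) → ¬ nonEmpty w

  IsSink : Node → Set
  IsSink x = ∀ e → tail e ≢ x

  SingleSinkReachable : Node → Set
  SingleSinkReachable r = IsSink r × (∀ x → IsSink x → x ≡ r) × (∀ x → Walk x r)

  IsSource : Node → Set
  IsSource x = ∀ e → head e ≢ x

  module WithRoot (r : Node) where

    TransDep : Line → Line → Set
    TransDep u w = u ≢ w × Σ Node (λ s → IsSource s × Σ (Walk s r) (λ p → OnWalk u p × OnWalk w p))

    IsCut : Subset m → Set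
    IsCut F = ∀ s → IsSource s → (p : Walk s r) → Σ Line (λ e → e ∈ F × OnWalk e p)

    InfCap : Subset m → Line → Set
    InfCap A e = e ∉ A × Σ Line (λ a → a ∈ A × TransDep a e)

    -- total capacity of F (sum of capacities: ∞ iff some line of F has
    -- capacity ∞, otherwise every line costs 1 and the total is |F|)
    data CutCost (A F : Subset m) : ℕ∞ → Set where
      costInf : Σ Line (λ e → e ∈ F × InfCap A e) → CutCost A F ∞
      costFin : (∀ e → e ∈ F → ¬ InfCap A e) → CutCost A F (fin ∣ F ∣)

    IsLambda : Subset m → ℕ∞ → Set
    IsLambda A v =
      Σ (Subset m) (λ F → IsCut F × CutCost A F v) ×
      (∀ F c → IsCut F → CutCost A F c → v ≤∞ c)

module _ {m : ℕ} (V : Fin m → Set) (Adj : Fin m → Fin m → Set) where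

  Independent : Subset m → Set
  Independent S = (∀ u → u ∈ S → V u) × (∀ u w → u ∈ S → w ∈ S → ¬ Adj u w)

  MaximalIndependent : Subset m → Set
  MaximalIndependent S = Independent S × (∀ T → Independent T → ¬ (S ⊂ T))

module _ (D : Digraph) (r : Fin (Digraph.n D)) where
  open Digraph D
  open WithRoot D r

  VG : Fin m → Set
  VG _ = ⊤

  V' : (k : ℕ) (λ₁ : Fin m → ℕ∞) → Fin m → Set
  V' k λ₁ u = ¬ (k <∞ λ₁ u)

  El : (k : ℕ) (λ₁ : Fin m → ℕ∞) (λ₂ : Fin m → Fin m → ℕ∞) → Fin m → Fin m → Set
  El k λ₁ λ₂ u w = V' k λ₁ u × V' k λ₁ w × u ≢ w × ¬ TransDep u w × k <∞ λ₂ u w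

  E' : (k : ℕ) (λ₁ : Fin m → ℕ∞) (λ₂ : Fin m → Fin m → ℕ∞) → Fin m → Fin m → Set
  E' k λ₁ λ₂ u w = V' k λ₁ u × V' k λ₁ w × (TransDep u w ⊎ El k λ₁ λ₂ u w)

-- A maximal independent set S of the line dependency graph meets every
-- source-to-r path. Otherwise take such a path avoiding S. By maximality each
-- of its lines is transitively dependent on a line of S; walking along the
-- path from the source, one shows inductively that this line of S always lies
-- downstream of the current line, since a line of S upstream would either be
-- dependent on the line of S found downstream at the previous step or close a
-- cycle. At r there is no downstream line left. So S is a cut, and for A ⊆ S
-- no line of S is adjacent to A, whence λ_A ≤ |S| ≤ k. Hence S avoids dl and
-- spans no edge of el, and maximality transfers because E' ⊇ E on V'.
module Submission where

open import Defs
open import Data.Nat using (ℕ; _≤_; _<_)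
open import Data.Nat.Properties using (<-≤-trans; <-irrefl; ≤-trans)
open import Data.Fin using (Fin; _≟_)
open import Data.Fin.Subset using (Subset; ⁅_⁆; _∪_; ∣_∣; _∈_; _∉_; _⊆_; _⊂_)
open import Data.Fin.Subset.Properties
  using (x∈p∪q⁻; x∈p∪q⁺; p⊆p∪q; x∈⁅x⁆; x∈⁅y⁆⇒x≡y; _∈?_)
open import Data.Product using (Σ; _×_; _,_; proj₁; proj₂)
open import Data.Sum using (_⊎_; inj₁; inj₂; [_,_])
open import Data.Empty using (⊥; ⊥-elim)
open import Data.Unit using (tt)
open import Function using (_∘_)
open import Relation.Nullary using (¬_; yes; no)
open import Relation.Unary using (Pred; Decidable)
open import Relation.Binary.PropositionalEquality using (_≡_; refl; sym; subst)

⁅x⁆⊆p : ∀ {n} {x : Fin n} {p : Subset n} → x ∈ p → ⁅ x ⁆ ⊆ p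
⁅x⁆⊆p {x = x} x∈p y∈⁅x⁆ = subst (_∈ _) (sym (x∈⁅y⁆⇒x≡y x y∈⁅x⁆)) x∈p

∪-lub : ∀ {n} {p q r : Subset n} → p ⊆ r → q ⊆ r → p ∪ q ⊆ r
∪-lub {p = p} {q} p⊆r q⊆r x∈p∪q = [ p⊆r , q⊆r ] (x∈p∪q⁻ p q x∈p∪q)

≤∞fin⇒¬<∞ : ∀ {k v j} → v ≤∞ fin j → j ≤ k → ¬ (k <∞ v)
≤∞fin⇒¬<∞ (fin≤fin b≤j) j≤k (fin<fin k<b) = <-irrefl refl (<-≤-trans k<b (≤-trans b≤j j≤k))

module _ {m : ℕ} {V : Fin m → Set} {Adj : Fin m → Fin m → Set} where

  independent-∪⁅⁆ : ∀ {S e} → (∀ {u w} → Adj u w → Adj w u) → ¬ Adj e e → V e →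
                    Independent V Adj S → (∀ c → c ∈ S → ¬ Adj c e) →
                    Independent V Adj (S ∪ ⁅ e ⁆)
  independent-∪⁅⁆ {S} {e} sym-Adj irrefl-e Ve (V-S , indep-S) indep-e =
    (λ u u∈ → [ V-S u , (λ u∈⁅e⁆ → subst V (sym (x∈⁅y⁆⇒x≡y e u∈⁅e⁆)) Ve) ] (x∈p∪q⁻ S ⁅ e ⁆ u∈)) ,
    (λ u w u∈ w∈ → pairs u w (x∈p∪q⁻ S ⁅ e ⁆ u∈) (x∈p∪q⁻ S ⁅ e ⁆ w∈))
    where
    pairs : ∀ u w → u ∈ S ⊎ u ∈ ⁅ e ⁆ → w ∈ S ⊎ w ∈ ⁅ e ⁆ → ¬ Adj u w
    pairs u w (inj₁ u∈S) (inj₁ w∈S) = indep-S u w u∈S w∈S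
    pairs u w (inj₁ u∈S) (inj₂ w∈⁅e⁆) rewrite x∈⁅y⁆⇒x≡y e w∈⁅e⁆ = indep-e u u∈S
    pairs u w (inj₂ u∈⁅e⁆) (inj₁ w∈S) rewrite x∈⁅y⁆⇒x≡y e u∈⁅e⁆ = indep-e w w∈S ∘ sym-Adj
    pairs u w (inj₂ u∈⁅e⁆) (inj₂ w∈⁅e⁆)
      rewrite x∈⁅y⁆⇒x≡y e u∈⁅e⁆ | x∈⁅y⁆⇒x≡y e w∈⁅e⁆ = irrefl-e

  independent-weaken : ∀ {V₀ : Fin m → Set} {Adj₀ : Fin m → Fin m → Set} {T} →
                       (∀ u → V u → V₀ u) → (∀ u w → V u → V w → Adj₀ u w → Adj u w) →
                       Independent V Adj T → Independent V₀ Adj₀ T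
  independent-weaken V⊆V₀ Adj₀⊆Adj (V-T , indep-T) =
    (λ u u∈T → V⊆V₀ u (V-T u u∈T)) ,
    (λ u w u∈T w∈T → indep-T u w u∈T w∈T ∘ Adj₀⊆Adj u w (V-T u u∈T) (V-T w w∈T))

module Walks (D : Digraph) where
  open Digraph D

  infixr 5 _++_
  _++_ : ∀ {x y z} → Walk D x y → Walk D y z → Walk D x z
  []           ++ q = q
  step e eq p ++ q = step e eq (p ++ q)

  onWalk-++ˡ : ∀ {c x y z} {p : Walk D x y} (q : Walk D y z) → OnWalk D c p → OnWalk D c (p ++ q)
  onWalk-++ˡ q (here eq p)          = here eq (p ++ q)
  onWalk-++ˡ q (there f eq p c∈p) = there f eq (p ++ q) (onWalk-++ˡ q c∈p)

  onWalk-++ʳ : ∀ {c x y z} (p : Walk D x y) {q : Walk D y z} → OnWalk D c q → OnWalk D c (p ++ q)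
  onWalk-++ʳ []            c∈q = c∈q
  onWalk-++ʳ (step f eq p) c∈q = there f eq (p ++ _) (onWalk-++ʳ p c∈q)

  onWalk-++⁻ : ∀ {c x y z} (p : Walk D x y) {q : Walk D y z} →
               OnWalk D c (p ++ q) → OnWalk D c p ⊎ OnWalk D c q
  onWalk-++⁻ []            c∈q                  = inj₂ c∈q
  onWalk-++⁻ (step f eq p) (here _ _)           = inj₁ (here eq p)
  onWalk-++⁻ (step f eq p) (there _ _ _ c∈p++q) with onWalk-++⁻ p c∈p++q
  ... | inj₁ c∈p = inj₁ (there f eq p c∈p)
  ... | inj₂ c∈q = inj₂ c∈q

  onWalk-step⁻ : ∀ {c e x y} {eq : tail e ≡ x} {p : Walk D (head e) y} →
                 OnWalk D c (step e eq p) → c ≡ e ⊎ OnWalk D c p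
  onWalk-step⁻ (here _ _)        = inj₁ refl
  onWalk-step⁻ (there _ _ _ c∈p) = inj₂ c∈p

  record Through (e : Line D) {x y} (p : Walk D x y) : Set where
    constructor through
    field
      before : Walk D x (tail e)
      after  : Walk D (head e) y
      splits : p ≡ before ++ step e refl after

  through-onWalk : ∀ {e x y} {p : Walk D x y} → OnWalk D e p → Through e p
  through-onWalk (here refl p) = through [] p refl
  through-onWalk (there f eq p e∈p) with through-onWalk e∈p
  ... | through before after refl = through (step f eq before) after refl

  onWalk-through⁻ : ∀ {c e x y} {p : Walk D x y} (t : Through e p) → OnWalk D c p →
                    OnWalk D c (Through.before t) ⊎ c ≡ e ⊎ OnWalk D c (Through.after t)
  onWalk-through⁻ (through before after refl) c∈p
    with onWalk-++⁻ before c∈p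
  ... | inj₁ c∈before = inj₁ c∈before
  ... | inj₂ c∈rest   = inj₂ (onWalk-step⁻ c∈rest)

  onWalk-¬IsSink-start : ∀ {e x y} {p : Walk D x y} → OnWalk D e p → ¬ IsSink D x
  onWalk-¬IsSink-start (here eq _)      snk = snk _ eq
  onWalk-¬IsSink-start (there f eq _ _) snk = snk f eq

  reachable-¬IsSource : ∀ e {x y} → head e ≡ x → Walk D x y → ¬ IsSource D y
  reachable-¬IsSource e e↦x []           src = src e e↦x
  reachable-¬IsSource e _   (step f _ p)     = reachable-¬IsSource f refl p

  acyclic-¬onWalk-before-after : Acyclic D → ∀ {c x y z} {p : Walk D x y} {q : Walk D y z} →
                                  OnWalk D c p → OnWalk D c q → ⊥
  acyclic-¬onWalk-before-after acyc {c} c∈p c∈q =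
    acyc (tail c) (step c refl (Through.after (through-onWalk c∈p) ++
                                Through.before (through-onWalk c∈q))) tt

  onWalk-dec : ∀ {ℓ} {P : Pred (Line D) ℓ} → Decidable P → ∀ {x y} (p : Walk D x y) →
               Σ (Line D) (λ e → P e × OnWalk D e p) ⊎ (∀ e → OnWalk D e p → ¬ P e)
  onWalk-dec P? []           = inj₂ λ _ ()
  onWalk-dec P? (step e eq p) with P? e | onWalk-dec P? p
  ... | yes Pe | _                   = inj₁ (e , Pe , here eq p)
  ... | no _   | inj₁ (f , Pf , f∈p) = inj₁ (f , Pf , there e eq p f∈p)
  ... | no ¬Pe | inj₂ ¬P             = inj₂ λ f f∈ → [ (λ { refl → ¬Pe }) , ¬P f ] (onWalk-step⁻ f∈)

module _ (D : Digraph) (r : Fin (Digraph.n D)) where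
  open Digraph D
  open WithRoot D r

  transDep-sym : ∀ {u w} → TransDep u w → TransDep w u
  transDep-sym (u≢w , s , src , p , u∈p , w∈p) = u≢w ∘ sym , s , src , p , w∈p , u∈p

  isLambda-≤-independentCut : ∀ {A v S} → IsLambda A v → IsCut S →
                              Independent (VG D r) TransDep S → A ⊆ S → v ≤∞ fin ∣ S ∣
  isLambda-≤-independentCut {S = S} (_ , minimal) cut (_ , indep) A⊆S =
    minimal S _ cut (costFin λ e e∈S (_ , a , a∈A , a~e) → indep a e (A⊆S a∈A) e∈S a~e)

module MaximalIndependentCut (D : Digraph) (acyc : Acyclic D) (r : Fin (Digraph.n D))
  (sink-r : SingleSinkReachable D r) (r-has-input : ¬ IsSource D r)
  (S : Subset (Digraph.m D)) (maxS : MaximalIndependent (VG D r) (WithRoot.TransDep D r) S)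
  where
  open Digraph D
  open WithRoot D r
  open Walks D

  MeetsS : Node D → Set
  MeetsS x = Σ (Line D) λ a → a ∈ S × Σ (Walk D x r) (OnWalk D a)

  -- Invariant of the walk along an S-avoiding path: its current node is the
  -- source or already lies upstream of a line of S.
  Entry : Node D → Set
  Entry x = IsSource D x ⊎ MeetsS x

  ¬entry-r : ¬ Entry r
  ¬entry-r (inj₁ src)                = r-has-input src
  ¬entry-r (inj₂ (_ , _ , _ , a∈q)) = onWalk-¬IsSink-start a∈q (proj₁ sink-r)

  S-upstream⇒¬entry : ∀ {c s y} → IsSource D s → (before : Walk D s y) →
                      c ∈ S → OnWalk D c before → ¬ Entry y
  S-upstream⇒¬entry src before c∈S c∈before (inj₁ src′) =
    reachable-¬IsSource _ refl (Through.after (through-onWalk c∈before)) src′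
  S-upstream⇒¬entry {c} src before c∈S c∈before (inj₂ (a , a∈S , q , a∈q)) with c ≟ a
  ... | yes refl = acyclic-¬onWalk-before-after acyc c∈before a∈q
  ... | no c≢a   = proj₂ (proj₁ maxS) c a c∈S a∈S
                     (c≢a , _ , src , before ++ q , onWalk-++ˡ q c∈before , onWalk-++ʳ before a∈q)

  ¬transDep-entry : ∀ {c e} → c ∈ S → Entry (tail e) → ¬ MeetsS (head e) → ¬ TransDep c e
  ¬transDep-entry c∈S entry ¬meets (c≢e , s , src , q , c∈q , e∈q)
    with through-onWalk e∈q
  ... | t@(through before after _) with onWalk-through⁻ t c∈q
  ...   | inj₁ c∈before        = S-upstream⇒¬entry src before c∈S c∈before entry
  ...   | inj₂ (inj₁ c≡e)      = c≢e c≡e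
  ...   | inj₂ (inj₂ c∈after)  = ¬meets (_ , c∈S , after , c∈after)

  -- Only ¬ ¬: maximality refutes the independence of S ∪ ⁅ e ⁆ but yields no witness.
  entry-propagates : ∀ {e} → e ∉ S → Entry (tail e) → ¬ ¬ MeetsS (head e)
  entry-propagates {e} e∉S entry ¬meets = proj₂ maxS (S ∪ ⁅ e ⁆)
    (independent-∪⁅⁆ (transDep-sym D r) (λ e~e → proj₁ e~e refl) tt (proj₁ maxS)
                     (λ c c∈S → ¬transDep-entry c∈S entry ¬meets))
    (p⊆p∪q ⁅ e ⁆ , e , x∈p∪q⁺ (inj₂ (x∈⁅x⁆ e)) , e∉S)

  ¬entry-avoiding : ∀ {x} (p : Walk D x r) → (∀ e → OnWalk D e p → e ∉ S) → ¬ Entry x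
  ¬entry-avoiding []              _             = ¬entry-r
  ¬entry-avoiding (step e refl p) avoids entry =
    entry-propagates (avoids e (here refl p)) entry λ meets →
      ¬entry-avoiding p (λ f f∈p → avoids f (there e refl p f∈p)) (inj₂ meets)

  maximalIndependent-isCut : IsCut S
  maximalIndependent-isCut s src p with onWalk-dec (_∈? S) p
  ... | inj₁ meets   = meets
  ... | inj₂ avoids  = ⊥-elim (¬entry-avoiding p avoids (inj₁ src))

theorem1 : (D : Digraph) → NoParallel D → Acyclic D →
           (r : Fin (Digraph.n D)) → SingleSinkReachable D r →
           (k : ℕ) → 0 < k →
           (λ₁ : Fin (Digraph.m D) → ℕ∞) →
           (∀ u → WithRoot.IsLambda D r ⁅ u ⁆ (λ₁ u)) →
           (λ₂ : Fin (Digraph.m D) → Fin (Digraph.m D) → ℕ∞) →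
           (∀ u w → WithRoot.IsLambda D r (⁅ u ⁆ ∪ ⁅ w ⁆) (λ₂ u w)) →
           (S : Subset (Digraph.m D)) →
           MaximalIndependent (VG D r) (WithRoot.TransDep D r) S →
           ∣ S ∣ ≤ k →
           MaximalIndependent (V' D r k λ₁) (E' D r k λ₁ λ₂) S
theorem1 D _ acyc r sink-r k _ λ₁ isλ₁ λ₂ isλ₂ S maxS ∣S∣≤k = (S⊆V' , ¬E'-on-S) , maximal
  where
  open Digraph D
  open WithRoot D r
  indep : Independent (VG D r) TransDep S
  indep = proj₁ maxS

  cut : Fin m → IsCut S
  cut u = MaximalIndependentCut.maximalIndependent-isCut D acyc r sink-r
            (Walks.reachable-¬IsSource D u refl (proj₂ (proj₂ sink-r) (head u))) S maxS

  ¬k<λ : ∀ (u : Fin m) {A v} → IsLambda A v → A ⊆ S → ¬ (k <∞ v)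
  ¬k<λ u isλ A⊆S = ≤∞fin⇒¬<∞ (isLambda-≤-independentCut D r isλ (cut u) indep A⊆S) ∣S∣≤k

  S⊆V' : ∀ u → u ∈ S → V' D r k λ₁ u
  S⊆V' u u∈S = ¬k<λ u (isλ₁ u) (⁅x⁆⊆p u∈S)

  ¬E'-on-S : ∀ u w → u ∈ S → w ∈ S → ¬ E' D r k λ₁ λ₂ u w
  ¬E'-on-S u w u∈S w∈S (_ , _ , inj₁ u~w)                    = proj₂ indep u w u∈S w∈S u~w
  ¬E'-on-S u w u∈S w∈S (_ , _ , inj₂ (_ , _ , _ , _ , k<λ)) =
    ¬k<λ u (isλ₂ u w) (∪-lub (⁅x⁆⊆p u∈S) (⁅x⁆⊆p w∈S)) k<λ

  maximal : ∀ T → Independent (V' D r k λ₁) (E' D r k λ₁ λ₂) T → ¬ (S ⊂ T)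
  maximal T indep-T = proj₂ maxS T
    (independent-weaken (λ _ _ → tt) (λ _ _ u∈V' w∈V' u~w → u∈V' , w∈V' , inj₁ u~w) indep-T)
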